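{- Let $s$ and $t$ be positive integers and let $F$ be a gerechte framework of order $n$ in which every region is either an $s \times t$ rectangle or a $t \times s$ rectangle. Then $F$ is realizable.
   Context: A gerechte framework of order $n$ is a partition of the cells of an $n\times n$ array into $n$ regions, each containing $n$ cells. A latin square of order $n$ is an $n\times n$ array with symbols $1,\dots,n$ in which each symbol appears exactly once in each row and once in each column. A latin square realizes a gerechte framework (and is a realization of it) if, when its cells are partitioned by the framework, each region contains each symbol exactly once; a framework with a realization is called realizable. A region is an $a\times b$ rectangle if it consists of the cells lying in some $a$ consecutive rows and some $b$ consecutive columns (height $a$, width $b$). (Since each region has $n$ cells, necessarily $n=st$ here.) -}

module Defs where

open import Data.Nat using (ℕ; _≤_; _<_; _+_)
open import Data.Fin using (Fin; toℕ)
open import Data.Product using (Σ; _×_; _,_; ∃; ∃-syntax; proj₁; proj₂)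
open import Relation.Binary.PropositionalEquality using (_≡_)
open import Function.Bundles using (_↔_; _⇔_)

-- Cells of an n×n array are pairs (row , column) : Fin n × Fin n.
Cell : ℕ → Set
Cell n = Fin n × Fin n

record Framework (n : ℕ) : Set where
  field
    region : Cell n → Fin n
    size   : (r : Fin n) → Σ (Cell n) (λ c → region c ≡ r) ↔ Fin n

open Framework public

-- A latin square of order n with symbols Fin n (standing for 1..n):
-- each symbol exactly once in each row and each column.
record LatinSquare (n : ℕ) : Set where
  field
    entry  : Fin n → Fin n → Fin n
    rowBij : (i : Fin n) → (k : Fin n) → ∃[ j ] (entry i j ≡ k × ((j' : Fin n) → entry i j' ≡ k → j' ≡ j))
    colBij : (j : Fin n) → (k : Fin n) → ∃[ i ] (entry i j ≡ k × ((i' : Fin n) → entry i' j ≡ k → i' ≡ i))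

open LatinSquare public

Realizes : {n : ℕ} → LatinSquare n → Framework n → Set
Realizes {n} L F =
  (r : Fin n) → (k : Fin n) →
  ∃[ c ] (region F c ≡ r × entry L (proj₁ c) (proj₂ c) ≡ k
         × ((c' : Cell n) → region F c' ≡ r
                → entry L (proj₁ c') (proj₂ c') ≡ k → c' ≡ c))

Realizable : {n : ℕ} → Framework n → Set
Realizable F = ∃[ L ] Realizes L F

IsRectangle : {n : ℕ} → Framework n → Fin n → ℕ → ℕ → Set
IsRectangle {n} F r a b =
  ∃[ p ] ∃[ q ] ((i j : Fin n) →
    (region F (i , j) ≡ r) ⇔ ((p ≤ toℕ i × toℕ i < p + a) × (q ≤ toℕ j × toℕ j < q + b)))

-- Write s = g s′ and t = g t′ with g = gcd s t, so that s′ and t′ are coprime. Apart from the degenerate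
-- case where one side is 1 and the other exceeds n (then every region is a full row or a full column,
-- an instance of s = n, t = 1), every region is a g s′ × g t′ or a g t′ × g s′ rectangle inside the grid.
--
-- The regions met by a row have widths g t′ and g s′, so all region corners lie on multiples of g, and the
-- row length gives t′ H + s′ V = g s′ t′ for the numbers H and V of horizontal and vertical regions met;
-- by coprimality H = s′ α and V = t′ β with α + β = g. Grouping these regions, from left to right, s′
-- horizontal or t′ vertical ones at a time gives each region a rank below g in its row; likewise in columns.
--
-- The symbol of a cell lies in Fin s′ × Fin t′ × Fin g × Fin g: the position of the cell's g × g block in
-- its region, each coordinate shifted by the other block coordinate of the region's corner, and the
-- position of the cell in its block, shifted by the row and column ranks of the region. In a row, equal
-- symbols force equal ranks, hence equal orientations, and then (by the shift and coprimality) the same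
-- region, hence the same cell; columns are symmetric, and within a region the block position and the
-- position in the block determine the cell.

module Submission where

open import Defs
import Axiom.UniquenessOfIdentityProofs as UIP
open import Data.Bool using (Bool; true; false; if_then_else_)
open import Data.Fin using (Fin; toℕ; fromℕ<; cast; combine) renaming (_≟_ to _≟ᶠ_)
import Data.Fin as Fin
open import Data.Fin.Properties
  using ( toℕ-fromℕ<; toℕ-injective; toℕ-cast; toℕ<n; combine-injective; injective⇒≤; punchOut-injective
        ; any?; *↔×; cantor-schröder-bernstein)
open import Data.Nat
open import Data.Nat.Properties
open import Data.Nat.DivMod
open import Data.Nat.Divisibility
open import Data.Nat.Coprimality using (Coprime; coprime-divisor; coprime-/gcd) renaming (sym to coprime-sym)
open import Data.Nat.GCD using (gcd; gcd[m,n]∣m; gcd[m,n]∣n; gcd[m,n]≢0)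
open import Data.Nat.Tactic.RingSolver using (solve-∀)
open import Data.Product using (Σ; _×_; _,_; proj₁; proj₂; swap; ∃-syntax)
open import Data.Product.Properties using (,-injective)
import Data.Sum as Sum
open import Data.Sum using (_⊎_; inj₁; inj₂; [_,_]′)
open import Function using (_∘_; _⇔_; mk⇔; Equivalence; Inverse; Injection; Injective)
open import Function.Properties.Inverse using (↔⇒↣; ↔-sym)
open import Relation.Binary.Definitions using (tri<; tri≈; tri>)
open import Relation.Binary.PropositionalEquality hiding ([_])
open import Relation.Nullary using (¬_; Dec; yes; no; contradiction)

InRange : ℕ → ℕ → ℕ → Set
InRange c w x = c ≤ x × x < c + w

%-cancelʳ-+ : ∀ a b c m .{{_ : NonZero m}} → (a + c) % m ≡ (b + c) % m → a % m ≡ b % m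
%-cancelʳ-+ a b c m@(suc m-1) eq = begin
  a % m                           ≡⟨ wrap a ⟩
  (a + c + c * m-1) % m           ≡⟨ %-distribˡ-+ (a + c) (c * m-1) m ⟩
  ((a + c) % m + c * m-1 % m) % m ≡⟨ cong (λ x → (x + c * m-1 % m) % m) eq ⟩
  ((b + c) % m + c * m-1 % m) % m ≡⟨ %-distribˡ-+ (b + c) (c * m-1) m ⟨
  (b + c + c * m-1) % m           ≡⟨ wrap b ⟨
  b % m                           ∎
  where
  open ≡-Reasoning
  wrap : ∀ x → x % m ≡ (x + c + c * m-1) % m
  wrap x = begin
    x % m                   ≡⟨ [m+kn]%n≡m%n x c m ⟨
    (x + c * m) % m         ≡⟨ cong (λ y → (x + y) % m) (*-suc c m-1) ⟩
    (x + (c + c * m-1)) % m ≡⟨ cong (_% m) (+-assoc x c (c * m-1)) ⟨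
    (x + c + c * m-1) % m   ∎

%-cancelˡ-+ : ∀ c a b m .{{_ : NonZero m}} → (c + a) % m ≡ (c + b) % m → a % m ≡ b % m
%-cancelˡ-+ c a b m eq = %-cancelʳ-+ a b c m
  (trans (cong (_% m) (+-comm a c)) (trans eq (cong (_% m) (+-comm c b))))

+-%-injectiveʳ : ∀ c m .{{_ : NonZero m}} {k l} → k < m → l < m → (c + k) % m ≡ (c + l) % m → k ≡ l
+-%-injectiveʳ c m k<m l<m eq =
  trans (sym (m<n⇒m%n≡m k<m)) (trans (%-cancelˡ-+ c _ _ m eq) (m<n⇒m%n≡m l<m))

%-injective-inRange : ∀ c m d .{{_ : NonZero m}} {x y} → InRange c m x → InRange c m y →
                      (x + d) % m ≡ (y + d) % m → x ≡ y
%-injective-inRange c m d {x} {y} x∈ y∈ eq = begin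
  x               ≡⟨ shift x∈ ⟨
  c + (x ∸ c)     ≡⟨ cong (c +_) (+-%-injectiveʳ c m (offset< x∈) (offset< y∈) offsets) ⟩
  c + (y ∸ c)     ≡⟨ shift y∈ ⟩
  y               ∎
  where
  open ≡-Reasoning
  shift : ∀ {z} → InRange c m z → c + (z ∸ c) ≡ z
  shift (c≤z , _) = m+[n∸m]≡n c≤z
  offset< : ∀ {z} → InRange c m z → z ∸ c < m
  offset< {z} (_ , z<c+m) = m<n+o⇒m∸n<o z c z<c+m
  offsets : (c + (x ∸ c)) % m ≡ (c + (y ∸ c)) % m
  offsets = subst₂ (λ u v → u % m ≡ v % m) (sym (shift x∈)) (sym (shift y∈)) (%-cancelʳ-+ x y d m eq)

/-%-injective : ∀ m .{{_ : NonZero m}} {a b} → a / m ≡ b / m → a % m ≡ b % m → a ≡ b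
/-%-injective m {a} {b} a/m≡b/m a%m≡b%m = begin
  a                   ≡⟨ m≡m%n+[m/n]*n a m ⟩
  a % m + (a / m) * m ≡⟨ cong₂ (λ r q → r + q * m) a%m≡b%m a/m≡b/m ⟩
  b % m + (b / m) * m ≡⟨ m≡m%n+[m/n]*n b m ⟨
  b                   ∎
  where open ≡-Reasoning

coprime⇒*-cancelˡ-% : ∀ {s t} .{{_ : NonZero s}} → Coprime s t →
                      ∀ x y → (t * x) % s ≡ (t * y) % s → x % s ≡ y % s
coprime⇒*-cancelˡ-% {s} {t} cop x y eq =
  [ (λ x≤y → cancel x≤y eq) , (λ y≤x → sym (cancel y≤x (sym eq))) ]′ (≤-total x y)
  where
  cancel : ∀ {x y} → x ≤ y → (t * x) % s ≡ (t * y) % s → x % s ≡ y % s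
  cancel {x} {y} x≤y eq = trans (sym (%-remove-+ʳ x s∣y∸x)) (cong (_% s) (m+[n∸m]≡n x≤y))
    where
    shifted : (t * x + t * (y ∸ x)) % s ≡ (t * x + 0) % s
    shifted = begin
      (t * x + t * (y ∸ x)) % s ≡⟨ cong (_% s) (*-distribˡ-+ t x (y ∸ x)) ⟨
      (t * (x + (y ∸ x))) % s   ≡⟨ cong (λ z → (t * z) % s) (m+[n∸m]≡n x≤y) ⟩
      (t * y) % s               ≡⟨ eq ⟨
      (t * x) % s               ≡⟨ cong (_% s) (+-identityʳ (t * x)) ⟨
      (t * x + 0) % s           ∎
      where open ≡-Reasoning
    s∣y∸x : s ∣ y ∸ x
    s∣y∸x = coprime-divisor cop (m%n≡0⇒n∣m (t * (y ∸ x)) s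
      (trans (%-cancelˡ-+ (t * x) _ 0 s shifted) (m<n⇒m%n≡m (>-nonZero⁻¹ s))))

/-inRange : ∀ g .{{_ : NonZero g}} {c w j} → InRange (g * c) (g * w) j → InRange c w (j / g)
/-inRange g {c} {w} {j} (gc≤j , j<gc+gw) = lower , upper
  where
  lower : c ≤ j / g
  lower = subst (_≤ j / g) (m*n/n≡m c g) (/-monoˡ-≤ g (subst (_≤ j) (*-comm g c) gc≤j))
  upper : j / g < c + w
  upper = m<n*o⇒m/o<n (subst (j <_) (trans (sym (*-distribˡ-+ g c w)) (*-comm g (c + w))) j<gc+gw)

/-inRange⁻¹ : ∀ g .{{_ : NonZero g}} {c w j} → InRange c w (j / g) → InRange (g * c) (g * w) j
/-inRange⁻¹ g {c} {w} {j} (c≤j/g , j/g<c+w) = lower , upper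
  where
  open ≤-Reasoning
  lower : g * c ≤ j
  lower = begin
    g * c       ≤⟨ *-monoʳ-≤ g c≤j/g ⟩
    g * (j / g) ≡⟨ *-comm g (j / g) ⟩
    j / g * g   ≤⟨ m/n*n≤m j g ⟩
    j           ∎
  upper : j < g * c + g * w
  upper = begin-strict
    j                   ≡⟨ m≡m%n+[m/n]*n j g ⟩
    j % g + j / g * g   <⟨ +-monoˡ-< (j / g * g) (m%n<n j g) ⟩
    suc (j / g) * g     ≤⟨ *-monoˡ-≤ g j/g<c+w ⟩
    (c + w) * g         ≡⟨ *-comm (c + w) g ⟩
    g * (c + w)         ≡⟨ *-distribˡ-+ g c w ⟩
    g * c + g * w       ∎

m<n∧o∣n⇒m/o<n/o : ∀ {m n} o .{{_ : NonZero o}} → o ∣ n → m < n → m / o < n / o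
m<n∧o∣n⇒m/o<n/o {m} o o∣n m<n = m<n*o⇒m/o<n (subst (m <_) (sym (m/n*n≡m o∣n)) m<n)

coprime-split : ∀ {s t} .{{_ : NonZero s}} .{{_ : NonZero t}} → Coprime s t →
                ∀ g a b → t * a + s * b ≡ s * (g * t) → s ∣ a × t ∣ b × a / s + b / t ≡ g
coprime-split {s} {t} cop g a b eq = s∣a , t∣b , *-cancelˡ-≡ _ _ t (*-cancelˡ-≡ _ _ s scaled)
  where
  s∣a : s ∣ a
  s∣a = coprime-divisor cop
    (∣m+n∣m⇒∣n (subst (s ∣_) (trans (sym eq) (+-comm (t * a) (s * b))) (m∣m*n (g * t))) (m∣m*n b))
  t∣b : t ∣ b
  t∣b = coprime-divisor (coprime-sym cop)
    (∣m+n∣m⇒∣n (subst (t ∣_) (sym eq) (∣n⇒∣m*n s (n∣m*n g))) (m∣m*n a))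
  scaled : s * (t * (a / s + b / t)) ≡ s * (t * g)
  scaled = begin
    s * (t * (a / s + b / t))             ≡⟨ distribute s t (a / s) (b / t) ⟩
    t * (s * (a / s)) + s * (t * (b / t)) ≡⟨ cong₂ (λ x y → t * x + s * y) (m*[n/m]≡n s∣a) (m*[n/m]≡n t∣b) ⟩
    t * a + s * b                         ≡⟨ eq ⟩
    s * (g * t)                           ≡⟨ cong (s *_) (*-comm g t) ⟩
    s * (t * g)                           ∎
    where
    open ≡-Reasoning
    distribute : ∀ s t x y → s * (t * (x + y)) ≡ t * (s * x) + s * (t * y)
    distribute = solve-∀

-- Latin squares from injective fillings

injective⇒surjective : ∀ {n} (f : Fin n → Fin n) → Injective _≡_ _≡_ f → ∀ y → ∃[ x ] f x ≡ y
injective⇒surjective {zero}  f _     ()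
injective⇒surjective {suc n} f f-inj y with any? (λ x → f x ≟ᶠ y)
... | yes hit = hit
... | no miss = contradiction (injective⇒≤ (f-inj ∘ punchOut-injective (avoids _) (avoids _))) 1+n≰n
  where
  avoids : ∀ x → y ≢ f x
  avoids x y≡fx = miss (x , sym y≡fx)

unique-preimage : ∀ {n} (f : Fin n → Fin n) → Injective _≡_ _≡_ f →
                 ∀ y → ∃[ x ] (f x ≡ y × ((x′ : Fin n) → f x′ ≡ y → x′ ≡ x))
unique-preimage f f-inj y with injective⇒surjective f f-inj y
... | x , fx≡y = x , fx≡y , λ x′ fx′≡y → f-inj (trans fx′≡y (sym fx≡y))

latinSquare : ∀ {n} (f : Fin n → Fin n → Fin n) →
              (∀ i → Injective _≡_ _≡_ (f i)) → (∀ j → Injective _≡_ _≡_ (λ i → f i j)) →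
              LatinSquare n
latinSquare f rows cols = record
  { entry  = f
  ; rowBij = λ i → unique-preimage (f i) (rows i)
  ; colBij = λ j → unique-preimage (λ i → f i j) (cols j)
  }

member-≡ : ∀ {n} (F : Framework n) {r c c′} (p : region F c ≡ r) (p′ : region F c′ ≡ r) →
           c ≡ c′ → _≡_ {A = Σ (Cell n) (λ c → region F c ≡ r)} (c , p) (c′ , p′)
member-≡ F p p′ refl = cong (_ ,_) (UIP.Decidable⇒UIP.≡-irrelevant _≟ᶠ_ p p′)

realizes : ∀ {n} (L : LatinSquare n) (F : Framework n) →
           (∀ {c c′ : Cell n} → region F c ≡ region F c′ →
              entry L (proj₁ c) (proj₂ c) ≡ entry L (proj₁ c′) (proj₂ c′) → c ≡ c′) →
           Realizes L F
realizes {n} L F injective r k = proj₁ (cellOf x) , proj₂ (cellOf x) , hit , unique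
  where
  cellOf : Fin n → Σ (Cell n) (λ c → region F c ≡ r)
  cellOf = Inverse.from (size F r)
  symbolAt : Fin n → Fin n
  symbolAt x = entry L (proj₁ (proj₁ (cellOf x))) (proj₂ (proj₁ (cellOf x)))
  symbolAt-injective : Injective _≡_ _≡_ symbolAt
  symbolAt-injective {x} {y} eq = Injection.injective (↔⇒↣ (↔-sym (size F r)))
    (member-≡ F (proj₂ (cellOf x)) (proj₂ (cellOf y))
      (injective (trans (proj₂ (cellOf x)) (sym (proj₂ (cellOf y)))) eq))
  x : Fin n
  x = proj₁ (injective⇒surjective symbolAt symbolAt-injective k)
  hit : symbolAt x ≡ k
  hit = proj₂ (injective⇒surjective symbolAt symbolAt-injective k)
  unique : (c′ : Cell n) → region F c′ ≡ r → entry L (proj₁ c′) (proj₂ c′) ≡ k → c′ ≡ proj₁ (cellOf x)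
  unique c′ c′∈r c′↦k = injective (trans c′∈r (sym (proj₂ (cellOf x)))) (trans c′↦k (sym hit))

-- Counting the segments of a line

indicator : Bool → Bool → ℕ
indicator true  true  = 1
indicator false false = 1
indicator _     _     = 0

indicator-refl : ∀ k → indicator k k ≡ 1
indicator-refl true  = refl
indicator-refl false = refl

tickIf : ∀ {P : Set} → Dec P → ℕ → ℕ
tickIf (yes _) m = m
tickIf (no _)  _ = 0

tickIf-yes : ∀ {P : Set} (d : Dec P) {m} → P → tickIf d m ≡ m
tickIf-yes (yes _) _ = refl
tickIf-yes (no ¬p) p = contradiction p ¬p

tickIf-no : ∀ {P : Set} (d : Dec P) {m} → ¬ P → tickIf d m ≡ 0
tickIf-no (yes p) ¬p = contradiction p ¬p
tickIf-no (no _)  _  = refl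

module Counting (len : Bool → ℕ) (start : ℕ → ℕ) (kind : ℕ → Bool) where

  end : ℕ → ℕ
  end x = start x + len (kind x)

  -- count k x is the number of segments of kind k inside [0, x), each counted at its last position.
  count : Bool → ℕ → ℕ
  count k zero    = 0
  count k (suc x) = count k x + tickIf (suc x ≟ end x) (indicator (kind x) k)

  weight : ℕ → ℕ
  weight x = len true * count true x + len false * count false x

  weight-zero : weight 0 ≡ 0
  weight-zero = cong₂ _+_ (*-zeroʳ (len true)) (*-zeroʳ (len false))

  weight-suc : ∀ x → weight (suc x) ≡ weight x + tickIf (suc x ≟ end x) (len (kind x))
  weight-suc x = trans (expand a b (count true x) (count false x) _ _)
                       (cong (weight x +_) (ticks (suc x ≟ end x) (kind x)))
    where
    a = len true
    b = len false
    expand : ∀ a b u v p q → a * (u + p) + b * (v + q) ≡ a * u + b * v + (a * p + b * q)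
    expand = solve-∀
    ticks : ∀ {P : Set} (d : Dec P) k →
            a * tickIf d (indicator k true) + b * tickIf d (indicator k false) ≡ tickIf d (len k)
    ticks (yes _) true  = trans (cong₂ _+_ (*-identityʳ a) (*-zeroʳ b)) (+-identityʳ a)
    ticks (yes _) false = cong₂ _+_ (*-zeroʳ a) (*-identityʳ b)
    ticks (no _)  _     = cong₂ _+_ (*-zeroʳ a) (*-zeroʳ b)

  count-mono : ∀ k {x y} → x ≤ y → count k x ≤ count k y
  count-mono k {y = zero}  z≤n  = ≤-refl
  count-mono k {x} {suc y} x≤1+y with m≤n⇒m<n∨m≡n x≤1+y
  ... | inj₁ x<1+y = ≤-trans (count-mono k (s≤s⁻¹ x<1+y)) (m≤m+n (count k y) _)
  ... | inj₂ refl  = ≤-refl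

count-ext : ∀ len {start start′ kind kind′} k y →
            (∀ {x} → x < y → start x ≡ start′ x × kind x ≡ kind′ x) →
            Counting.count len start kind k y ≡ Counting.count len start′ kind′ k y
count-ext len k zero    _     = refl
count-ext len k (suc y) agree = cong₂ _+_
  (count-ext len k y (λ x<y → agree (m<n⇒m<1+n x<y)))
  (cong₂ (λ a κ → tickIf (suc y ≟ a + len κ) (indicator κ k)) (proj₁ (agree ≤-refl)) (proj₂ (agree ≤-refl)))

record Segmentation (n : ℕ) (len : Bool → ℕ) (start : ℕ → ℕ) (kind : ℕ → Bool) : Set where
  field
    inSegment   : ∀ {x} → x < n → InRange (start x) (len (kind x)) x
    segmentFits : ∀ {x} → x < n → start x + len (kind x) ≤ n
    sameSegment : ∀ {x y} → x < n → InRange (start x) (len (kind x)) y →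
                  start y ≡ start x × kind y ≡ kind x

module SegmentationProperties {n len start kind} (S : Segmentation n len start kind) where

  open Segmentation S
  open Counting len start kind public

  start≤ : ∀ {x} → x < n → start x ≤ x
  start≤ x<n = proj₁ (inSegment x<n)

  <end : ∀ {x} → x < n → x < end x
  <end x<n = proj₂ (inSegment x<n)

  start<n : ∀ {x} → x < n → start x < n
  start<n x<n = ≤-<-trans (start≤ x<n) x<n

  start-idem : ∀ {x} → x < n → start (start x) ≡ start x
  start-idem x<n = proj₁ (sameSegment x<n (≤-refl , ≤-<-trans (start≤ x<n) (<end x<n)))

  len-pos : ∀ {x} → x < n → 0 < len (kind x)
  len-pos {x} x<n = +-cancelˡ-< (start x) 0 _
    (subst (_< end x) (sym (+-identityʳ (start x))) (≤-<-trans (start≤ x<n) (<end x<n)))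

  same-end : ∀ {x y} → x < n → InRange (start x) (len (kind x)) y → end y ≡ end x
  same-end x<n y∈ = cong₂ (λ a k → a + len k) (proj₁ same) (proj₂ same)
    where same = sameSegment x<n y∈

  start-suc-inside : ∀ {x} → suc x < n → suc x ≢ end x → start (suc x) ≡ start x
  start-suc-inside {x} 1+x<n 1+x≢end =
    proj₁ (sameSegment x<n (≤-trans (start≤ x<n) (n≤1+n x) , ≤∧≢⇒< (<end x<n) 1+x≢end))
    where x<n = <-trans (n<1+n x) 1+x<n

  start-suc-boundary : ∀ {x} → suc x < n → suc x ≡ end x → start (suc x) ≡ suc x
  start-suc-boundary {x} 1+x<n 1+x≡end with m≤n⇒m<n∨m≡n (start≤ 1+x<n)
  ... | inj₂ eq = eq
  ... | inj₁ start<1+x = contradiction (trans 1+x≡end ends-later) (<⇒≢ (<end 1+x<n))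
    where
    ends-later : end x ≡ end (suc x)
    ends-later = same-end 1+x<n (s≤s⁻¹ start<1+x , <-trans (n<1+n x) (<end 1+x<n))

  weight≡start : ∀ x → x < n → weight x ≡ start x
  weight≡start zero    0<n   = trans weight-zero (sym (n≤0⇒n≡0 (start≤ 0<n)))
  weight≡start (suc x) 1+x<n = trans (weight-suc x) (step (suc x ≟ end x))
    where
    IH : weight x ≡ start x
    IH = weight≡start x (<-trans (n<1+n x) 1+x<n)
    step : (d : Dec (suc x ≡ end x)) → weight x + tickIf d (len (kind x)) ≡ start (suc x)
    step (yes 1+x≡end) =
      trans (cong (_+ len (kind x)) IH) (trans (sym 1+x≡end) (sym (start-suc-boundary 1+x<n 1+x≡end)))
    step (no 1+x≢end)  = trans (+-identityʳ _) (trans IH (sym (start-suc-inside 1+x<n 1+x≢end)))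

  weight-total : weight n ≡ n
  weight-total = total n refl
    where
    total : ∀ m → m ≡ n → weight m ≡ m
    total zero    _     = weight-zero
    total (suc x) 1+x≡n = begin
      weight (suc x)                                   ≡⟨ weight-suc x ⟩
      weight x + tickIf (suc x ≟ end x) (len (kind x)) ≡⟨ cong₂ _+_ (weight≡start x x<n)
                                                                     (tickIf-yes (suc x ≟ end x) last) ⟩
      end x                                            ≡⟨ last ⟨
      suc x                                            ∎
      where
      open ≡-Reasoning
      x<n : x < n
      x<n = subst (x <_) 1+x≡n ≤-refl
      last : suc x ≡ end x
      last = ≤-antisym (<end x<n) (subst (end x ≤_) (sym 1+x≡n) (segmentFits x<n))

  count-inside : ∀ k {x} → x < n → ∀ d → start x + d < end x → count k (start x + d) ≡ count k (start x)
  count-inside k {x} x<n zero _ = cong (count k) (+-identityʳ (start x))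
  count-inside k {x} x<n (suc d) lt = begin
    count k (start x + suc d)                                 ≡⟨ cong (count k) (+-suc (start x) d) ⟩
    count k y + tickIf (suc y ≟ end y) (indicator (kind y) k) ≡⟨ cong (count k y +_) (tickIf-no (suc y ≟ end y) not-last) ⟩
    count k y + 0                                             ≡⟨ +-identityʳ _ ⟩
    count k y                                                 ≡⟨ count-inside k x<n d (<-trans (n<1+n y) 1+y<end) ⟩
    count k (start x)                                         ∎
    where
    open ≡-Reasoning
    y = start x + d
    1+y<end : suc y < end x
    1+y<end = subst (_< end x) (+-suc (start x) d) lt
    not-last : suc y ≢ end y
    not-last 1+y≡end =
      <-irrefl (trans 1+y≡end (same-end x<n (m≤m+n (start x) d , <-trans (n<1+n y) 1+y<end))) 1+y<end

  count-end : ∀ k {x} → x < n → count k (end x) ≡ count k (start x) + indicator (kind x) k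
  count-end k {x} x<n = begin
    count k (end x)                                           ≡⟨ cong (count k) end≡1+y ⟩
    count k y + tickIf (suc y ≟ end y) (indicator (kind y) k) ≡⟨ cong₂ _+_ (count-inside k x<n ℓ-1 y<end)
                                                                           (tickIf-yes (suc y ≟ end y) last) ⟩
    count k (start x) + indicator (kind y) k                  ≡⟨ cong (λ κ → count k (start x) + indicator κ k) same-kind ⟩
    count k (start x) + indicator (kind x) k                  ∎
    where
    open ≡-Reasoning
    ℓ-1 = pred (len (kind x))
    y = start x + ℓ-1
    end≡1+y : end x ≡ suc y
    end≡1+y = trans (cong (start x +_) (sym (suc-pred (len (kind x)) ⦃ >-nonZero (len-pos x<n) ⦄)))
                    (+-suc (start x) ℓ-1)
    y<end : y < end x
    y<end = subst (y <_) (sym end≡1+y) ≤-refl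
    y∈ : InRange (start x) (len (kind x)) y
    y∈ = m≤m+n (start x) ℓ-1 , y<end
    last : suc y ≡ end y
    last = trans (sym end≡1+y) (sym (same-end x<n y∈))
    same-kind : kind y ≡ kind x
    same-kind = proj₂ (sameSegment x<n y∈)

  count<count-end : ∀ {k x} → x < n → kind x ≡ k → count k (start x) < count k (end x)
  count<count-end {k} {x} x<n refl = begin-strict
    count k (start x)                        <⟨ m<m+n _ z<s ⟩
    count k (start x) + 1                    ≡⟨ cong (count k (start x) +_) (indicator-refl k) ⟨
    count k (start x) + indicator (kind x) k ≡⟨ count-end k x<n ⟨
    count k (end x)                          ∎
    where open ≤-Reasoning hiding (start)

  count<total : ∀ {k x} → x < n → kind x ≡ k → count k (start x) < count k n
  count<total x<n κ = <-≤-trans (count<count-end x<n κ) (count-mono _ (segmentFits x<n))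

  disjoint : ∀ {x y} → x < n → y < n → start x < start y → end x ≤ start y
  disjoint {x} {y} x<n y<n sx<sy with end x ≤? start y
  ... | yes end≤ = end≤
  ... | no end≰ = contradiction (trans (sym (start-idem y<n)) sharedStart) (>⇒≢ sx<sy)
    where
    sharedStart : start (start y) ≡ start x
    sharedStart = proj₁ (sameSegment x<n (<⇒≤ sx<sy , ≰⇒> end≰))

  count-injective : ∀ {k x y} → x < n → y < n → kind x ≡ k → kind y ≡ k →
                    count k (start x) ≡ count k (start y) → start x ≡ start y
  count-injective {k} {x} {y} x<n y<n κx κy same with <-cmp (start x) (start y)
  ... | tri≈ _ eq _ = eq
  ... | tri< sx<sy _ _ = contradiction same
                           (<⇒≢ (<-≤-trans (count<count-end x<n κx) (count-mono k (disjoint x<n y<n sx<sy))))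
  ... | tri> _ _ sy<sx = contradiction (sym same)
                           (<⇒≢ (<-≤-trans (count<count-end y<n κy) (count-mono k (disjoint y<n x<n sy<sx))))

-- Tilings of the grid by (g s) × (g t) and (g t) × (g s) rectangles

-- Cells are pairs of naturals below N. A horizontal region r is the (g s) × (g t) rectangle with top-left
-- corner (top r , left r); a vertical one is (g t) × (g s).
record Tiling (N g s t : ℕ) : Set where
  field
    coprime    : Coprime s t
    N≡         : N ≡ (g * s) * (g * t)
    regionOf   : ℕ → ℕ → Fin N
    horizontal : Fin N → Bool
    top left   : Fin N → ℕ
    box        : ∀ r {i j} → i < N → j < N →
                 regionOf i j ≡ r ⇔ (InRange (top r) (g * (if horizontal r then s else t)) i
                                   × InRange (left r) (g * (if horizontal r then t else s)) j)
    fits       : ∀ r → top r + g * (if horizontal r then s else t) ≤ N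
                     × left r + g * (if horizontal r then t else s) ≤ N

transpose : ∀ {N g s t} → Tiling N g s t → Tiling N g t s
transpose {g = g} {s} {t} T = record
  { coprime    = coprime-sym coprime
  ; N≡         = trans N≡ (*-comm (g * s) (g * t))
  ; regionOf   = λ i j → regionOf j i
  ; horizontal = horizontal
  ; top        = left
  ; left       = top
  ; box        = λ r i<N j<N → let e = box r j<N i<N in
                   mk⇔ (swap ∘ Equivalence.to e) (Equivalence.from e ∘ swap)
  ; fits       = swap ∘ fits
  }
  where open Tiling T

mod≡⇒%≡ : ∀ {x y m} .{{_ : NonZero m}} → x mod m ≡ y mod m → x % m ≡ y % m
mod≡⇒%≡ {x} {y} {m} eq = trans (sym (toℕ-fromℕ< (m%n<n x m))) (trans (cong toℕ eq) (toℕ-fromℕ< (m%n<n y m)))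

module Rows {N g s t} ⦃ g≢0 : NonZero g ⦄ ⦃ s≢0 : NonZero s ⦄ ⦃ t≢0 : NonZero t ⦄
            (T : Tiling N g s t) where

  open Tiling T

  across along : Bool → ℕ
  across k = if k then s else t
  along  k = if k then t else s

  instance
    across≢0 : ∀ {k} → NonZero (across k)
    across≢0 {true}  = s≢0
    across≢0 {false} = t≢0

    along≢0 : ∀ {k} → NonZero (along k)
    along≢0 {true}  = t≢0
    along≢0 {false} = s≢0

  coprime-across : ∀ k → Coprime (across k) (along k)
  coprime-across true  = coprime
  coprime-across false = coprime-sym coprime

  height width : Fin N → ℕ
  height r = g * across (horizontal r)
  width  r = g * along (horizontal r)

  in-box : ∀ {i j} → i < N → j < N → InRange (top (regionOf i j)) (height (regionOf i j)) i
                                    × InRange (left (regionOf i j)) (width (regionOf i j)) j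
  in-box i<N j<N = Equivalence.to (box _ i<N j<N) refl

  rowSegmentation : ∀ {i} → i < N →
                    Segmentation N (λ k → g * along k) (λ j → left (regionOf i j)) (λ j → horizontal (regionOf i j))
  rowSegmentation {i} i<N = record
    { inSegment   = λ j<N → proj₂ (in-box i<N j<N)
    ; segmentFits = λ {j} _ → proj₂ (fits (regionOf i j))
    ; sameSegment = λ {j} j<N j′∈ → let e = region-along j<N j′∈ in cong left e , cong horizontal e
    }
    where
    region-along : ∀ {j j′} → j < N → InRange (left (regionOf i j)) (width (regionOf i j)) j′ →
                 regionOf i j′ ≡ regionOf i j
    region-along {j} j<N j′∈ = Equivalence.from (box (regionOf i j) i<N j′<N) (proj₁ (in-box i<N j<N) , j′∈)
      where j′<N = <-≤-trans (proj₂ j′∈) (proj₂ (fits (regionOf i j)))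

  module Row {i} (i<N : i < N) = SegmentationProperties (rowSegmentation i<N)

  rowCount : ℕ → Bool → ℕ → ℕ
  rowCount i = Counting.count (λ k → g * along k) (λ j → left (regionOf i j)) (λ j → horizontal (regionOf i j))

  offset : ℕ → ℕ → ℕ
  offset i x = t * rowCount i true x + s * rowCount i false x

  weight≡g*offset : ∀ {i} (i<N : i < N) x → Row.weight i<N x ≡ g * offset i x
  weight≡g*offset {i} _ x = factor g t s (rowCount i true x) (rowCount i false x)
    where
    factor : ∀ g t s u v → g * t * u + g * s * v ≡ g * (t * u + s * v)
    factor = solve-∀

  left≡g*offset : ∀ {i j} → i < N → j < N → left (regionOf i j) ≡ g * offset i (left (regionOf i j))
  left≡g*offset {i} {j} i<N j<N = begin
    left (regionOf i j)                   ≡⟨ Row.start-idem i<N j<N ⟨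
    left (regionOf i (left (regionOf i j))) ≡⟨ Row.weight≡start i<N _ (Row.start<n i<N j<N) ⟨
    Row.weight i<N (left (regionOf i j))  ≡⟨ weight≡g*offset i<N (left (regionOf i j)) ⟩
    g * offset i (left (regionOf i j))    ∎
    where open ≡-Reasoning

  left/g≡offset : ∀ {i j} → i < N → j < N → left (regionOf i j) / g ≡ offset i (left (regionOf i j))
  left/g≡offset i<N j<N = trans (cong (_/ g) (trans (left≡g*offset i<N j<N) (*-comm g _))) (m*n/n≡m _ g)

  leftBlock-inRange : ∀ {i j} → i < N → j < N →
                      InRange (left (regionOf i j) / g) (along (horizontal (regionOf i j))) (j / g)
  leftBlock-inRange {i} {j} i<N j<N = subst (λ c → InRange c w (j / g)) (sym (left/g≡offset i<N j<N))
    (/-inRange g (subst (λ ℓ → InRange ℓ (g * w) j) (left≡g*offset i<N j<N) (proj₂ (in-box i<N j<N))))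
    where w = along (horizontal (regionOf i j))

  same-block⇒same-region : ∀ {i j j′} → i < N → j < N → j′ < N → j / g ≡ j′ / g → regionOf i j′ ≡ regionOf i j
  same-block⇒same-region {i} {j} {j′} i<N j<N j′<N j/g≡j′/g =
    Equivalence.from (box (regionOf i j) i<N j′<N) (proj₁ (in-box i<N j<N) , j′∈)
    where
    w = along (horizontal (regionOf i j))
    j′∈ : InRange (left (regionOf i j)) (width (regionOf i j)) j′
    j′∈ = subst (λ ℓ → InRange ℓ (g * w) j′) (sym (left≡g*offset i<N j<N))
      (/-inRange⁻¹ g (subst₂ (λ c x → InRange c w x) (left/g≡offset i<N j<N) j/g≡j′/g
                                                       (leftBlock-inRange i<N j<N)))

  region-at-left : ∀ {i j} → i < N → j < N → regionOf i (left (regionOf i j)) ≡ regionOf i j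
  region-at-left {i} {j} i<N j<N = Equivalence.from (box (regionOf i j) i<N (Row.start<n i<N j<N))
    (proj₁ (in-box i<N j<N) , ≤-refl , ≤-<-trans (Row.start≤ i<N j<N) (Row.<end i<N j<N))

  row-totals : ∀ {i} → i < N → s ∣ rowCount i true N × t ∣ rowCount i false N
                            × rowCount i true N / s + rowCount i false N / t ≡ g
  row-totals {i} i<N = coprime-split coprime g _ _ (*-cancelˡ-≡ _ _ g (begin
    g * offset i N     ≡⟨ trans (sym (weight≡g*offset i<N N)) (Row.weight-total i<N) ⟩
    N                  ≡⟨ N≡ ⟩
    g * s * (g * t)    ≡⟨ *-assoc g s (g * t) ⟩
    g * (s * (g * t))  ∎))
    where open ≡-Reasoning

  -- The horizontal regions of a row, from left to right, are grouped s at a time and the vertical ones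
  -- t at a time; by row-totals there are g groups, and rank numbers them, horizontal groups first.
  rankIn : (Bool → ℕ → ℕ) → Bool → ℕ → ℕ
  rankIn c true  x = c true x / s
  rankIn c false x = c true N / s + c false x / t

  rank : ℕ → ℕ → ℕ
  rank i j = rankIn (rowCount i) (horizontal (regionOf i j)) (left (regionOf i j))

  rowCount<total : ∀ {i j} → i < N → j < N → let r = regionOf i j in
                   rowCount i (horizontal r) (left r) < rowCount i (horizontal r) N
  rowCount<total i<N j<N = Row.count<total i<N j<N refl

  horizontal-rank< : ∀ {i} → i < N → ∀ x → rowCount i true x < rowCount i true N →
                    rankIn (rowCount i) true x < rowCount i true N / s
  horizontal-rank< i<N x = m<n∧o∣n⇒m/o<n/o s (proj₁ (row-totals i<N))

  vertical-rank<g : ∀ {i} → i < N → ∀ x → rowCount i false x < rowCount i false N → rankIn (rowCount i) false x < g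
  vertical-rank<g {i} i<N x lt = subst (rankIn (rowCount i) false x <_) (proj₂ (proj₂ (row-totals i<N)))
    (+-monoʳ-< (rowCount i true N / s) (m<n∧o∣n⇒m/o<n/o t (proj₁ (proj₂ (row-totals i<N))) lt))

  rank<g : ∀ {i j} → i < N → j < N → rank i j < g
  rank<g {i} {j} i<N j<N = bound (horizontal (regionOf i j)) (rowCount<total i<N j<N)
    where
    x = left (regionOf i j)
    bound : ∀ k → rowCount i k x < rowCount i k N → rankIn (rowCount i) k x < g
    bound true  lt = <-≤-trans (horizontal-rank< i<N x lt) (m+n≤o⇒m≤o _ (≤-reflexive (proj₂ (proj₂ (row-totals i<N)))))
    bound false lt = vertical-rank<g i<N x lt

  rank-horizontal : ∀ {i j j′} → i < N → j < N → j′ < N → rank i j ≡ rank i j′ →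
                    horizontal (regionOf i j) ≡ horizontal (regionOf i j′)
  rank-horizontal {i} {j} {j′} i<N j<N j′<N = kinds _ _ (rowCount<total i<N j<N) (rowCount<total i<N j′<N)
    where
    x = left (regionOf i j)
    y = left (regionOf i j′)
    kinds : ∀ k k′ → rowCount i k x < rowCount i k N → rowCount i k′ y < rowCount i k′ N →
            rankIn (rowCount i) k x ≡ rankIn (rowCount i) k′ y → k ≡ k′
    kinds true  true  _  _  _  = refl
    kinds false false _  _  _  = refl
    kinds true  false lt _  eq = contradiction eq (<⇒≢ (<-≤-trans (horizontal-rank< i<N x lt) (m≤m+n _ _)))
    kinds false true  _  lt eq = contradiction (sym eq) (<⇒≢ (<-≤-trans (horizontal-rank< i<N y lt) (m≤m+n _ _)))

  offset%across : ∀ i k x → offset i x % across k ≡ (along k * rowCount i k x) % across k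
  offset%across i true  x = %-remove-+ʳ (t * rowCount i true x) (m∣m*n (rowCount i false x))
  offset%across i false x = %-remove-+ˡ (s * rowCount i false x) (m∣m*n (rowCount i true x))

  rankIn-cancel : ∀ c k {x y} → rankIn c k x ≡ rankIn c k y → c k x / across k ≡ c k y / across k
  rankIn-cancel c true  eq = eq
  rankIn-cancel c false eq = +-cancelˡ-≡ _ _ _ eq

  -- The rank fixes the quotient by across k of the number of earlier regions of kind k, and the phase
  -- fixes its remainder, since left / g = offset = t · #horizontal + s · #vertical with s, t coprime.
  rank∧phase⇒same-region : ∀ {i j j′ k} → i < N → j < N → j′ < N →
               horizontal (regionOf i j) ≡ k → horizontal (regionOf i j′) ≡ k → rank i j ≡ rank i j′ →
               (i / g + left (regionOf i j) / g) % across k ≡ (i / g + left (regionOf i j′) / g) % across k →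
               regionOf i j ≡ regionOf i j′
  rank∧phase⇒same-region {i} {j} {j′} {k} i<N j<N j′<N κ κ′ same-rank same-phase = begin
    regionOf i j                    ≡⟨ region-at-left i<N j<N ⟨
    regionOf i ℓ                    ≡⟨ cong (regionOf i) same-left ⟩
    regionOf i ℓ′                   ≡⟨ region-at-left i<N j′<N ⟩
    regionOf i j′                   ∎
    where
    open ≡-Reasoning
    ℓ  = left (regionOf i j)
    ℓ′ = left (regionOf i j′)
    c  = rowCount i k
    same-quot : c ℓ / across k ≡ c ℓ′ / across k
    same-quot = rankIn-cancel (rowCount i) k
      (subst₂ (λ κ κ′ → rankIn (rowCount i) κ ℓ ≡ rankIn (rowCount i) κ′ ℓ′) κ κ′ same-rank)
    same-rem : c ℓ % across k ≡ c ℓ′ % across k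
    same-rem = coprime⇒*-cancelˡ-% (coprime-across k) (c ℓ) (c ℓ′) (begin
      (along k * c ℓ) % across k   ≡⟨ offset%across i k ℓ ⟨
      offset i ℓ % across k        ≡⟨ cong (_% across k) (left/g≡offset i<N j<N) ⟨
      (ℓ / g) % across k           ≡⟨ %-cancelˡ-+ (i / g) (ℓ / g) (ℓ′ / g) (across k) same-phase ⟩
      (ℓ′ / g) % across k          ≡⟨ cong (_% across k) (left/g≡offset i<N j′<N) ⟩
      offset i ℓ′ % across k       ≡⟨ offset%across i k ℓ′ ⟩
      (along k * c ℓ′) % across k  ∎)
    same-left : ℓ ≡ ℓ′
    same-left = Row.count-injective i<N j<N j′<N κ κ′ (/-%-injective (across k) same-quot same-rem)

  rank-row-invariant : ∀ {i i′ j j′} → i′ < N → j′ < N → (∀ {x} → x < N → regionOf i x ≡ regionOf i′ x) →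
                      regionOf i j ≡ regionOf i′ j′ → rank i j ≡ rank i′ j′
  rank-row-invariant {i} {i′} {j} {j′} i′<N j′<N same-row same-region =
    trans (cong (λ r → rankIn (rowCount i) (horizontal r) (left r)) same-region) (same-rankIn (horizontal (regionOf i′ j′)))
    where
    ℓ = left (regionOf i′ j′)
    ℓ≤N : ℓ ≤ N
    ℓ≤N = <⇒≤ (Row.start<n i′<N j′<N)
    same-count : ∀ k x → x ≤ N → rowCount i k x ≡ rowCount i′ k x
    same-count k x x≤N = count-ext (λ κ → g * along κ) k x
      (λ y<x → let e = same-row (<-≤-trans y<x x≤N) in cong left e , cong horizontal e)
    same-rankIn : ∀ k → rankIn (rowCount i) k ℓ ≡ rankIn (rowCount i′) k ℓ
    same-rankIn true  = cong (_/ s) (same-count true ℓ ℓ≤N)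
    same-rankIn false = cong₂ (λ a b → a / s + b / t) (same-count true N ≤-refl) (same-count false ℓ ℓ≤N)

  rowDigit : ℕ → ℕ → Fin g
  rowDigit i j = (i % g + rank i j) mod g

  rowDigit-rank : ∀ {i j j′} → i < N → j < N → j′ < N → rowDigit i j ≡ rowDigit i j′ → rank i j ≡ rank i j′
  rowDigit-rank {i} i<N j<N j′<N eq = +-%-injectiveʳ (i % g) g (rank<g i<N j<N) (rank<g i<N j′<N) (mod≡⇒%≡ eq)

  rowDigit-injective : ∀ {i i′ j j′} → i / g ≡ i′ / g → rank i j ≡ rank i′ j′ → rowDigit i j ≡ rowDigit i′ j′ → i ≡ i′
  rowDigit-injective {i} {i′} {j} {j′} same-block same-rank eq = /-%-injective g same-block (begin
    i % g      ≡⟨ m%n%n≡m%n i g ⟨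
    i % g % g  ≡⟨ %-cancelʳ-+ (i % g) (i′ % g) (rank i j) g shifted ⟩
    i′ % g % g ≡⟨ m%n%n≡m%n i′ g ⟩
    i′ % g     ∎)
    where
    open ≡-Reasoning
    shifted : (i % g + rank i j) % g ≡ (i′ % g + rank i j) % g
    shifted = trans (mod≡⇒%≡ eq) (cong (λ r → (i′ % g + r) % g) (sym same-rank))

cast-injective : ∀ {m n} .(eq : m ≡ n) {u v : Fin m} → cast eq u ≡ cast eq v → u ≡ v
cast-injective eq {u} {v} same = toℕ-injective (trans (sym (toℕ-cast eq u)) (trans (cong toℕ same) (toℕ-cast eq v)))

module Symbols {N g s t} ⦃ g≢0 : NonZero g ⦄ ⦃ s≢0 : NonZero s ⦄ ⦃ t≢0 : NonZero t ⦄
               (T : Tiling N g s t) where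

  open Tiling T
  open Rows T
  private module Cols = Rows (transpose T)

  digits : (k : Bool) → Fin (across k) → Fin (along k) → Fin s × Fin t
  digits true  a b = a , b
  digits false a b = b , a

  digits-injective : ∀ k {a a′ b b′} → digits k a b ≡ digits k a′ b′ → a ≡ a′ × b ≡ b′
  digits-injective true  = ,-injective
  digits-injective false = swap ∘ ,-injective

  -- Reduced modulo the region's extent in blocks, the block row (column) of a cell locates its block in
  -- the region; the shift by the corner's other coordinate separates regions of a row that share a rank.
  phaseDigits : ℕ → ℕ → Fin s × Fin t
  phaseDigits i j = digits k ((i / g + left r / g) mod across k) ((j / g + top r / g) mod along k)
    where
    r = regionOf i j
    k = horizontal r

  colDigit : ℕ → ℕ → Fin g
  colDigit i j = Cols.rowDigit j i

  code : ℕ → ℕ → (Fin s × Fin t) × Fin g × Fin g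
  code i j = phaseDigits i j , rowDigit i j , colDigit i j

  rank-block : ∀ {i i′ j j′} → i < N → i′ < N → j′ < N → i / g ≡ i′ / g →
               regionOf i j ≡ regionOf i′ j′ → rank i j ≡ rank i′ j′
  rank-block i<N i′<N j′<N same-block =
    rank-row-invariant i′<N j′<N (λ x<N → sym (Cols.same-block⇒same-region x<N i<N i′<N same-block))

  colRank-block : ∀ {i i′ j j′} → j < N → j′ < N → i′ < N → j / g ≡ j′ / g →
                  regionOf i j ≡ regionOf i′ j′ → Cols.rank j i ≡ Cols.rank j′ i′
  colRank-block j<N j′<N i′<N same-block =
    Cols.rank-row-invariant j′<N i′<N (λ x<N → sym (same-block⇒same-region x<N j<N j′<N same-block))

  row-injective : ∀ {i j j′} → i < N → j < N → j′ < N → code i j ≡ code i j′ → j ≡ j′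
  row-injective {i} {j} {j′} i<N j<N j′<N same-code
    with same-phase , same-digits ← ,-injective same-code
    with same-row , same-col ← ,-injective same-digits =
    Cols.rowDigit-injective same-block (colRank-block j<N j′<N i<N same-block same-region) same-col
    where
    r = regionOf i j
    k = horizontal r
    same-rank : rank i j ≡ rank i j′
    same-rank = rowDigit-rank i<N j<N j′<N same-row
    same-kind : horizontal (regionOf i j′) ≡ k
    same-kind = sym (rank-horizontal i<N j<N j′<N same-rank)
    phaseDigitsAs : Bool → Fin s × Fin t
    phaseDigitsAs κ = digits κ ((i / g + left (regionOf i j′) / g) mod across κ)
                               ((j′ / g + top (regionOf i j′) / g) mod along κ)
    phases : (i / g + left r / g) mod across k ≡ (i / g + left (regionOf i j′) / g) mod across k
           × (j / g + top r / g) mod along k ≡ (j′ / g + top (regionOf i j′) / g) mod along k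
    phases = digits-injective k (trans same-phase (cong phaseDigitsAs same-kind))
    same-region : r ≡ regionOf i j′
    same-region = rank∧phase⇒same-region i<N j<N j′<N refl same-kind same-rank (mod≡⇒%≡ (proj₁ phases))
    colPhase′ : Fin N → Fin (along k)
    colPhase′ ρ = (j′ / g + top ρ / g) mod along k
    same-block : j / g ≡ j′ / g
    same-block = %-injective-inRange (left r / g) (along k) (top r / g) (leftBlock-inRange i<N j<N)
      (subst (λ ρ → InRange (left ρ / g) (along (horizontal ρ)) (j′ / g)) (sym same-region)
             (leftBlock-inRange i<N j′<N))
      (mod≡⇒%≡ (trans (proj₂ phases) (cong colPhase′ (sym same-region))))

  region-injective : ∀ {i j i′ j′} → i < N → j < N → i′ < N → j′ < N → regionOf i j ≡ regionOf i′ j′ →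
                    code i j ≡ code i′ j′ → i ≡ i′ × j ≡ j′
  region-injective {i} {j} {i′} {j′} i<N j<N i′<N j′<N same-region same-code
    with same-phase , same-digits ← ,-injective same-code
    with same-row , same-col ← ,-injective same-digits =
      rowDigit-injective same-rowBlock (rank-block i<N i′<N j′<N same-rowBlock same-region) same-row
    , Cols.rowDigit-injective same-colBlock (colRank-block j<N j′<N i′<N same-colBlock same-region) same-col
    where
    r = regionOf i j
    k = horizontal r
    phaseDigits′ : Fin N → Fin s × Fin t
    phaseDigits′ ρ = digits (horizontal ρ) ((i′ / g + left ρ / g) mod across (horizontal ρ))
                                           ((j′ / g + top ρ / g) mod along (horizontal ρ))
    phases : (i / g + left r / g) mod across k ≡ (i′ / g + left r / g) mod across k
           × (j / g + top r / g) mod along k ≡ (j′ / g + top r / g) mod along k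
    phases = digits-injective k (trans same-phase (cong phaseDigits′ (sym same-region)))
    same-rowBlock : i / g ≡ i′ / g
    same-rowBlock = %-injective-inRange (top r / g) (across k) (left r / g) (Cols.leftBlock-inRange j<N i<N)
      (subst (λ ρ → InRange (top ρ / g) (across (horizontal ρ)) (i′ / g)) (sym same-region)
             (Cols.leftBlock-inRange j′<N i′<N))
      (mod≡⇒%≡ (proj₁ phases))
    same-colBlock : j / g ≡ j′ / g
    same-colBlock = %-injective-inRange (left r / g) (along k) (top r / g) (leftBlock-inRange i<N j<N)
      (subst (λ ρ → InRange (left ρ / g) (along (horizontal ρ)) (j′ / g)) (sym same-region)
             (leftBlock-inRange i′<N j′<N))
      (mod≡⇒%≡ (proj₂ phases))

module Realization {N g s t} ⦃ g≢0 : NonZero g ⦄ ⦃ s≢0 : NonZero s ⦄ ⦃ t≢0 : NonZero t ⦄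
                   (T : Tiling N g s t) where

  open Tiling T
  open Symbols T
  private module Sᵀ = Symbols (transpose T)

  code-transpose : ∀ {i j i′ j′} → code i j ≡ code i′ j′ → Sᵀ.code j i ≡ Sᵀ.code j′ i′
  code-transpose {i} {j} {i′} {j′} same-code
    with same-phase , same-digits ← ,-injective same-code
    with same-row , same-col ← ,-injective same-digits =
    cong₂ _,_ (trans (flip i j) (trans (cong swap same-phase) (sym (flip i′ j′)))) (cong₂ _,_ same-col same-row)
    where
    flipDigits : ∀ k a b → Sᵀ.digits k b a ≡ swap (digits k a b)
    flipDigits true  _ _ = refl
    flipDigits false _ _ = refl
    flip : ∀ i j → Sᵀ.phaseDigits j i ≡ swap (phaseDigits i j)
    flip i j = flipDigits (horizontal (regionOf i j)) _ _

  codes≡N : s * t * g * g ≡ N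
  codes≡N = trans (rearrange s t g) (sym N≡)
    where
    rearrange : ∀ s t g → s * t * g * g ≡ g * s * (g * t)
    rearrange = solve-∀

  encode : (Fin s × Fin t) × Fin g × Fin g → Fin N
  encode ((a , b) , x , y) = cast codes≡N (combine (combine (combine a b) x) y)

  encode-injective : Injective _≡_ _≡_ encode
  encode-injective {(a , b) , x , y} {(a′ , b′) , x′ , y′} same
    with same₃ , refl ← combine-injective (combine (combine a b) x) y (combine (combine a′ b′) x′) y′
                                          (cast-injective codes≡N same)
    with same₂ , refl ← combine-injective (combine a b) x (combine a′ b′) x′ same₃
    with refl , refl ← combine-injective a b a′ b′ same₂ = refl

  symbolAt : Fin N → Fin N → Fin N
  symbolAt i j = encode (code (toℕ i) (toℕ j))

  square : LatinSquare N
  square = latinSquare symbolAt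
    (λ i {j} {j′} same → toℕ-injective (row-injective (toℕ<n i) (toℕ<n j) (toℕ<n j′) (encode-injective same)))
    (λ j {i} {i′} same → toℕ-injective
      (Sᵀ.row-injective (toℕ<n j) (toℕ<n i) (toℕ<n i′) (code-transpose (encode-injective same))))

  realizable : (F : Framework N) → (∀ i j → regionOf (toℕ i) (toℕ j) ≡ region F (i , j)) → Realizable F
  realizable F same-regions = square , realizes square F λ {(i , j)} {(i′ , j′)} same-region same-symbol →
    let same = region-injective (toℕ<n i) (toℕ<n j) (toℕ<n i′) (toℕ<n j′)
                 (trans (same-regions i j) (trans same-region (sym (same-regions i′ j′))))
                 (encode-injective same-symbol)
    in cong₂ _,_ (toℕ-injective (proj₁ same)) (toℕ-injective (proj₂ same))

-- Rectangular regions of a framework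

RectangleAt : ∀ {n} → Framework n → Fin n → ℕ → ℕ → ℕ → ℕ → Set
RectangleAt {n} F r p q a b = (i j : Fin n) → region F (i , j) ≡ r ⇔ (InRange p a (toℕ i) × InRange q b (toℕ j))

clip< : ∀ {n p a x} → InRange p a x → x < n → x ∸ p < a ⊓ (n ∸ p)
clip< {n} {p} {a} {x} (p≤x , x<p+a) x<n =
  ⊓-glb (subst (x ∸ p <_) (m+n∸m≡n p a) (∸-monoˡ-< x<p+a p≤x)) (∸-monoˡ-< x<n p≤x)

unclip : ∀ {n p a y} → y < a ⊓ (n ∸ p) → InRange p a (p + y) × p + y < n
unclip {n} {p} {a} {y} y<clip = (m≤m+n p y , +-monoʳ-< p (<-≤-trans y<clip (m⊓n≤m a _))) , p+y<n
  where
  y<n∸p : y < n ∸ p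
  y<n∸p = <-≤-trans y<clip (m⊓n≤n a _)
  p+y<n : p + y < n
  p+y<n = subst (_< n) (+-comm y p)
    (m≤o∸n⇒m+n≤o (suc y) (<⇒≤ (m∸n≢0⇒n<m (>⇒≢ (≤-<-trans z≤n y<n∸p)))) y<n∸p)

-- A rectangle may stick out of the grid; only its intersection with the grid counts.
rectangle-size : ∀ {n} (F : Framework n) {r p q a b} → RectangleAt F r p q a b → n ≡ (a ⊓ (n ∸ p)) * (b ⊓ (n ∸ q))
rectangle-size {n} F {r} {p} {q} {a} {b} rect =
  cantor-schröder-bernstein {f = index} {g = cellAt} index-injective cellAt-injective
  where
  A = a ⊓ (n ∸ p)
  B = b ⊓ (n ∸ q)
  Member = Σ (Cell n) (λ c → region F c ≡ r)

  offsets : Member → Fin A × Fin B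
  offsets ((i , j) , ij∈r) = fromℕ< (clip< (proj₁ ij∈box) (toℕ<n i)) , fromℕ< (clip< (proj₂ ij∈box) (toℕ<n j))
    where ij∈box = Equivalence.to (rect i j) ij∈r

  member : Fin A × Fin B → Member
  member (x , y) = (fromℕ< (proj₂ x′) , fromℕ< (proj₂ y′)) ,
    Equivalence.from (rect _ _) ( subst (InRange p a) (sym (toℕ-fromℕ< _)) (proj₁ x′)
                                , subst (InRange q b) (sym (toℕ-fromℕ< _)) (proj₁ y′))
    where
    x′ = unclip {n} (toℕ<n x)
    y′ = unclip {n} (toℕ<n y)

  offsets-injective : Injective _≡_ _≡_ offsets
  offsets-injective {(i , j) , ij∈r} {(i′ , j′) , ij∈r′} same =
    member-≡ F ij∈r ij∈r′ (cong₂ _,_ (toℕ-injective (∸-cancelʳ-≡ (proj₁ (proj₁ box)) (proj₁ (proj₁ box′)) same-i))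
                                     (toℕ-injective (∸-cancelʳ-≡ (proj₁ (proj₂ box)) (proj₁ (proj₂ box′)) same-j)))
    where
    box  = Equivalence.to (rect i j) ij∈r
    box′ = Equivalence.to (rect i′ j′) ij∈r′
    same-i : toℕ i ∸ p ≡ toℕ i′ ∸ p
    same-i = trans (sym (toℕ-fromℕ< _)) (trans (cong (toℕ ∘ proj₁) same) (toℕ-fromℕ< _))
    same-j : toℕ j ∸ q ≡ toℕ j′ ∸ q
    same-j = trans (sym (toℕ-fromℕ< _)) (trans (cong (toℕ ∘ proj₂) same) (toℕ-fromℕ< _))

  member-injective : Injective _≡_ _≡_ member
  member-injective {x , y} {x′ , y′} same = cong₂ _,_
    (toℕ-injective (+-cancelˡ-≡ p _ _ (trans (sym (toℕ-fromℕ< _)) (trans (cong (toℕ ∘ proj₁ ∘ proj₁) same)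
                                                                        (toℕ-fromℕ< _)))))
    (toℕ-injective (+-cancelˡ-≡ q _ _ (trans (sym (toℕ-fromℕ< _)) (trans (cong (toℕ ∘ proj₂ ∘ proj₁) same)
                                                                        (toℕ-fromℕ< _)))))

  index : Fin n → Fin (A * B)
  index = Inverse.from *↔× ∘ offsets ∘ Inverse.from (size F r)

  cellAt : Fin (A * B) → Fin n
  cellAt = Inverse.to (size F r) ∘ member ∘ Inverse.to *↔×

  index-injective : Injective _≡_ _≡_ index
  index-injective = Injection.injective (↔⇒↣ (↔-sym (size F r))) ∘ offsets-injective
                  ∘ Injection.injective (↔⇒↣ (↔-sym *↔×))

  cellAt-injective : Injective _≡_ _≡_ cellAt
  cellAt-injective = Injection.injective (↔⇒↣ *↔×) ∘ member-injective ∘ Injection.injective (↔⇒↣ (size F r))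

positive-factors : ∀ {a b} → 0 < a * b → 0 < a × 0 < b
positive-factors {suc a} {zero}  0<ab = contradiction (*-zeroʳ (suc a)) (>⇒≢ 0<ab)
positive-factors {suc _} {suc _} _    = z<s , z<s

clipped≡ˡ : ∀ {A B a b} → A ≤ a → B ≤ b → A * B ≡ a * b → 0 < b → A ≡ a
clipped≡ˡ {A} {B} {a} {suc b} A≤a B≤b AB≡ab _ = *-cancelʳ-≡ A a (suc b)
  (≤-antisym (*-monoˡ-≤ (suc b) A≤a) (subst (_≤ A * suc b) AB≡ab (*-monoʳ-≤ A B≤b)))

≤∸⇒+≤ : ∀ {n p a} → 0 < a → a ≤ n ∸ p → p + a ≤ n
≤∸⇒+≤ {n} {p} {a} 0<a a≤n∸p =
  subst (_≤ n) (+-comm a p) (m≤o∸n⇒m+n≤o a (<⇒≤ (m∸n≢0⇒n<m (>⇒≢ (<-≤-trans 0<a a≤n∸p)))) a≤n∸p)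

rectangle-fits : ∀ {n} (F : Framework n) {r p q a b} → RectangleAt F r p q a b → a * b ≡ n → 0 < n →
                 p + a ≤ n × q + b ≤ n
rectangle-fits {n} F {p = p} {q} {a} {b} rect ab≡n 0<n =
  ≤∸⇒+≤ 0<a (m⊓n≡m⇒m≤n (clipped≡ˡ (m⊓n≤m a _) (m⊓n≤m b _) AB≡ab 0<b)) ,
  ≤∸⇒+≤ 0<b (m⊓n≡m⇒m≤n (clipped≡ˡ (m⊓n≤m b _) (m⊓n≤m a _) (trans (*-comm B A) (trans AB≡ab (*-comm a b))) 0<a))
  where
  A = a ⊓ (n ∸ p)
  B = b ⊓ (n ∸ q)
  AB≡ab : A * B ≡ a * b
  AB≡ab = trans (sym (rectangle-size F rect)) (sym ab≡n)
  0<a×0<b : 0 < a × 0 < b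
  0<a×0<b = positive-factors (subst (0 <_) (sym ab≡n) 0<n)
  0<a = proj₁ 0<a×0<b
  0<b = proj₂ 0<a×0<b

module FromFramework {N g s t} ⦃ g≢0 : NonZero g ⦄ ⦃ s≢0 : NonZero s ⦄ ⦃ t≢0 : NonZero t ⦄
  (F : Framework N) (coprime : Coprime s t) (N≡ : N ≡ (g * s) * (g * t))
  (rectangular : (r : Fin N) → IsRectangle F r (g * s) (g * t) ⊎ IsRectangle F r (g * t) (g * s)) where

  Shape : Fin N → Set
  Shape r = Σ Bool λ k → Σ ℕ λ p → Σ ℕ λ q →
            RectangleAt F r p q (g * (if k then s else t)) (g * (if k then t else s))

  shape : (r : Fin N) → Shape r
  shape r with rectangular r
  ... | inj₁ (p , q , rect) = true  , p , q , rect
  ... | inj₂ (p , q , rect) = false , p , q , rect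

  horizontal : Fin N → Bool
  horizontal r = proj₁ (shape r)

  top left : Fin N → ℕ
  top  r = proj₁ (proj₂ (shape r))
  left r = proj₁ (proj₂ (proj₂ (shape r)))

  area : ∀ k → g * (if k then s else t) * (g * (if k then t else s)) ≡ N
  area true  = sym N≡
  area false = trans (*-comm (g * t) (g * s)) (sym N≡)

  instance
    N≢0 : NonZero N
    N≢0 = subst NonZero (sym N≡) (m*n≢0 (g * s) (g * t) ⦃ m*n≢0 g s ⦄ ⦃ m*n≢0 g t ⦄)

  toFin : ℕ → Fin N
  toFin i = i mod N

  toℕ-toFin : ∀ {i} → i < N → toℕ (toFin i) ≡ i
  toℕ-toFin {i} i<N = trans (toℕ-fromℕ< (m%n<n i N)) (m<n⇒m%n≡m i<N)

  tiling : Tiling N g s t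
  tiling = record
    { coprime    = coprime
    ; N≡         = N≡
    ; regionOf   = λ i j → region F (toFin i , toFin j)
    ; horizontal = horizontal
    ; top        = top
    ; left       = left
    ; box        = λ r {i} {j} i<N j<N →
                     subst₂ (λ x y → region F (toFin i , toFin j) ≡ r ⇔ (InRange (top r) _ x × InRange (left r) _ y))
                       (toℕ-toFin i<N) (toℕ-toFin j<N) (proj₂ (proj₂ (proj₂ (shape r))) (toFin i) (toFin j))
    ; fits       = λ r → rectangle-fits F (proj₂ (proj₂ (proj₂ (shape r)))) (area (horizontal r)) (>-nonZero⁻¹ N)
    }

  regionOf-toℕ : ∀ i j → Tiling.regionOf tiling (toℕ i) (toℕ j) ≡ region F (i , j)
  regionOf-toℕ i j = cong₂ (λ x y → region F (x , y)) (toFin-toℕ i) (toFin-toℕ j)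
    where
    toFin-toℕ : (x : Fin N) → toFin (toℕ x) ≡ x
    toFin-toℕ x = toℕ-injective (toℕ-toFin (toℕ<n x))

realizable-coprime : ∀ {N g s t} ⦃ _ : NonZero g ⦄ ⦃ _ : NonZero s ⦄ ⦃ _ : NonZero t ⦄ →
                     Coprime s t → N ≡ (g * s) * (g * t) → (F : Framework N) →
                     ((r : Fin N) → IsRectangle F r (g * s) (g * t) ⊎ IsRectangle F r (g * t) (g * s)) →
                     Realizable F
realizable-coprime coprime N≡ F rectangular = Realization.realizable tiling F regionOf-toℕ
  where open FromFramework F coprime N≡ rectangular

realizable-rectangles : ∀ {n} s t → NonZero s → NonZero t → n ≡ s * t → (F : Framework n) →
                        ((r : Fin n) → IsRectangle F r s t ⊎ IsRectangle F r t s) → Realizable F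
realizable-rectangles s t s≢0 t≢0 n≡st F rectangular =
  realizable-coprime ⦃ g≢0 ⦄ ⦃ s′≢0 ⦄ ⦃ t′≢0 ⦄ (coprime-/gcd s t)
    (trans n≡st (cong₂ _*_ s≡ t≡)) F
    (Sum.map (subst₂ (IsRectangle F _) s≡ t≡) (subst₂ (IsRectangle F _) t≡ s≡) ∘ rectangular)
  where
  g = gcd s t
  instance
    g≢0 : NonZero g
    g≢0 = ≢-nonZero (gcd[m,n]≢0 s t (inj₁ (≢-nonZero⁻¹ s ⦃ s≢0 ⦄)))
  s≡ : s ≡ g * (s / g)
  s≡ = sym (m*[n/m]≡n (gcd[m,n]∣m s t))
  t≡ : t ≡ g * (t / g)
  t≡ = sym (m*[n/m]≡n (gcd[m,n]∣n s t))
  s′≢0 : NonZero (s / g)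
  s′≢0 = >-nonZero (m≥n⇒m/n>0 (∣⇒≤ ⦃ s≢0 ⦄ (gcd[m,n]∣m s t)))
  t′≢0 : NonZero (t / g)
  t′≢0 = >-nonZero (m≥n⇒m/n>0 (∣⇒≤ ⦃ t≢0 ⦄ (gcd[m,n]∣n s t)))

realizable-≤1 : ∀ {n} → n ≤ 1 → (F : Framework n) → Realizable F
realizable-≤1 {n} n≤1 F = square , realizes square F (λ _ _ → cong₂ _,_ (unique _ _) (unique _ _))
  where
  zero-index : (x : Fin n) → toℕ x ≡ 0
  zero-index x = n<1⇒n≡0 (<-≤-trans (toℕ<n x) n≤1)
  unique : (x y : Fin n) → x ≡ y
  unique x y = toℕ-injective (trans (zero-index x) (sym (zero-index y)))
  square : LatinSquare n
  square = latinSquare (λ i _ → i) (λ _ _ → unique _ _) (λ _ same → same)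

⊓≡1⇒≡1 : ∀ {n b} → 2 ≤ n → b ⊓ n ≡ 1 → b ≡ 1
⊓≡1⇒≡1 {b = 1}           _   _  = refl
⊓≡1⇒≡1 {b = suc (suc b)} 2≤n eq = contradiction eq (>⇒≢ (⊓-glb (s≤s (s≤s z≤n)) 2≤n))

clipped-product : ∀ {n a b} → 2 ≤ n → n ≡ (a ⊓ n) * (b ⊓ n) → n ≡ a * b ⊎ (n < a × b ≡ 1) ⊎ (n < b × a ≡ 1)
clipped-product {n} {a} {b} 2≤n n≡ with a ≤? n | b ≤? n
... | yes a≤n | yes b≤n = inj₁ (trans n≡ (cong₂ _*_ (m≤n⇒m⊓n≡m a≤n) (m≤n⇒m⊓n≡m b≤n)))
... | no a≰n  | _       = inj₂ (inj₁ (≰⇒> a≰n , ⊓≡1⇒≡1 2≤n (*-cancelˡ-≡ _ _ n ⦃ >-nonZero (<-trans z<s 2≤n) ⦄ (begin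
  n * (b ⊓ n)       ≡⟨ cong (_* (b ⊓ n)) (m≥n⇒m⊓n≡n (<⇒≤ (≰⇒> a≰n))) ⟨
  (a ⊓ n) * (b ⊓ n) ≡⟨ n≡ ⟨
  n                 ≡⟨ *-identityʳ n ⟨
  n * 1             ∎))))
  where open ≡-Reasoning
... | yes _   | no b≰n  = inj₂ (inj₂ (≰⇒> b≰n , ⊓≡1⇒≡1 2≤n (*-cancelʳ-≡ _ _ n ⦃ >-nonZero (<-trans z<s 2≤n) ⦄ (begin
  (a ⊓ n) * n       ≡⟨ cong ((a ⊓ n) *_) (m≥n⇒m⊓n≡n (<⇒≤ (≰⇒> b≰n))) ⟨
  (a ⊓ n) * (b ⊓ n) ≡⟨ n≡ ⟨
  n                 ≡⟨ *-identityˡ n ⟨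
  1 * n             ∎))))
  where open ≡-Reasoning

origin-size : ∀ {n} (F : Framework (suc n)) {p q a b} → RectangleAt F (region F (Fin.zero , Fin.zero)) p q a b →
              suc n ≡ (a ⊓ suc n) * (b ⊓ suc n)
origin-size F rect with Equivalence.to (rect Fin.zero Fin.zero) refl
... | (z≤n , _) , (z≤n , _) = rectangle-size F rect

origin-shape : ∀ {n s t} (F : Framework n) → 2 ≤ n → ((r : Fin n) → IsRectangle F r s t ⊎ IsRectangle F r t s) →
              n ≡ s * t ⊎ ∃[ x ] (n < x × ((s ≡ x × t ≡ 1) ⊎ (s ≡ 1 × t ≡ x)))
origin-shape {suc n} {s} {t} F 2≤n rectangular with rectangular (region F (Fin.zero , Fin.zero))
... | inj₁ (_ , _ , rect) with clipped-product 2≤n (origin-size F rect)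
...   | inj₁ n≡st               = inj₁ n≡st
...   | inj₂ (inj₁ (n<s , t≡1)) = inj₂ (s , n<s , inj₁ (refl , t≡1))
...   | inj₂ (inj₂ (n<t , s≡1)) = inj₂ (t , n<t , inj₂ (s≡1 , refl))
origin-shape {suc n} {s} {t} F 2≤n rectangular | inj₂ (_ , _ , rect) with clipped-product 2≤n (origin-size F rect)
...   | inj₁ n≡ts               = inj₁ (trans n≡ts (*-comm t s))
...   | inj₂ (inj₁ (n<t , s≡1)) = inj₂ (t , n<t , inj₂ (s≡1 , refl))
...   | inj₂ (inj₂ (n<s , t≡1)) = inj₂ (s , n<s , inj₁ (refl , t≡1))

≤∸⇒≡0 : ∀ {n p} → 0 < n → n ≤ n ∸ p → p ≡ 0
≤∸⇒≡0 {suc n} {zero}  _ _  = refl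
≤∸⇒≡0 {suc n} {suc p} _ le = contradiction (≤-trans le (m∸n≤m n p)) 1+n≰n

long-column : ∀ {n x} (F : Framework n) {r} → 0 < n → n < x → IsRectangle F r x 1 → IsRectangle F r n 1
long-column {n} {x} F 0<n n<x (p , q , rect) with ≤∸⇒≡0 {p = p} 0<n (begin
  n                                 ≡⟨ rectangle-size F rect ⟩
  (x ⊓ (n ∸ p)) * (1 ⊓ (n ∸ q))     ≤⟨ *-mono-≤ (m⊓n≤n x (n ∸ p)) (m⊓n≤m 1 (n ∸ q)) ⟩
  (n ∸ p) * 1                       ≡⟨ *-identityʳ (n ∸ p) ⟩
  n ∸ p                             ∎)
  where open ≤-Reasoning
... | refl = 0 , q , λ i j → mk⇔
  (λ ij∈r → (z≤n , toℕ<n i) , proj₂ (Equivalence.to (rect i j) ij∈r))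
  (λ ij∈box → Equivalence.from (rect i j) ((z≤n , <-trans (toℕ<n i) n<x) , proj₂ ij∈box))

long-row : ∀ {n x} (F : Framework n) {r} → 0 < n → n < x → IsRectangle F r 1 x → IsRectangle F r 1 n
long-row {n} {x} F 0<n n<x (p , q , rect) with ≤∸⇒≡0 {p = q} 0<n (begin
  n                                 ≡⟨ rectangle-size F rect ⟩
  (1 ⊓ (n ∸ p)) * (x ⊓ (n ∸ q))     ≤⟨ *-mono-≤ (m⊓n≤m 1 (n ∸ p)) (m⊓n≤n x (n ∸ q)) ⟩
  1 * (n ∸ q)                       ≡⟨ *-identityˡ (n ∸ q) ⟩
  n ∸ q                             ∎)
  where open ≤-Reasoning
... | refl = p , 0 , λ i j → mk⇔
  (λ ij∈r → proj₁ (Equivalence.to (rect i j) ij∈r) , (z≤n , toℕ<n j))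
  (λ ij∈box → Equivalence.from (rect i j) (proj₁ ij∈box , (z≤n , <-trans (toℕ<n j) n<x)))

long-rectangles : ∀ {n x} (F : Framework n) → 0 < n → n < x →
                  ((r : Fin n) → IsRectangle F r x 1 ⊎ IsRectangle F r 1 x) →
                  (r : Fin n) → IsRectangle F r n 1 ⊎ IsRectangle F r 1 n
long-rectangles F 0<n n<x rectangular = Sum.map (long-column F 0<n n<x) (long-row F 0<n n<x) ∘ rectangular

theorem1 : (s t n : ℕ) → NonZero s → NonZero t → (F : Framework n) →
    ((r : Fin n) → IsRectangle F r s t ⊎ IsRectangle F r t s) →
    Realizable F
theorem1 s t 0 _ _ F _ = realizable-≤1 z≤n F
theorem1 s t 1 _ _ F _ = realizable-≤1 ≤-refl F
theorem1 s t n@(suc (suc _)) s≢0 t≢0 F rectangular with origin-shape F (s≤s (s≤s z≤n)) rectangular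
... | inj₁ n≡st = realizable-rectangles s t s≢0 t≢0 n≡st F rectangular
... | inj₂ (x , n<x , inj₁ (refl , refl)) =
  realizable-rectangles n 1 _ _ (sym (*-identityʳ n)) F (long-rectangles F z<s n<x rectangular)
... | inj₂ (x , n<x , inj₂ (refl , refl)) =
  realizable-rectangles n 1 _ _ (sym (*-identityʳ n)) F (long-rectangles F z<s n<x (Sum.swap ∘ rectangular))
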